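{- Let $G=(V,E)$, $T$, $W$, monotone activation functions $f_{uv}$ and the graph $G'$ be as in the context. Let $\bar X\subseteq V(G')$ be an inclusion-wise minimal vertex set such that $T\subseteq\bar X$ and $G'[\bar X]$ is connected. Then $\bar X$ does not contain two distinct copies $v_i,v_j$ ($i\neq j$) of the same vertex $v\in V$.
   Context: Steiner tree activation instance: an undirected graph $G=(V,E)$, terminals $T\subseteq V$, a finite set $W\subseteq\mathbb{R}_{\ge0}$, and for each edge $uv\in E$ a monotone activation function $f_{uv}:W\times W\to\{\top,\bot\}$ (i.e. $f_{uv}(i,j)=\top$, $i\le i'$, $j\le j'$ imply $f_{uv}(i',j')=\top$). The graph $G'$ has vertex set consisting of the terminals $T$ (as separate vertices) together with a copy $v_i$ for each $v\in V$ and $i\in W$; $u_i$ and $v_j$ are adjacent iff $uv\in E$ and $f_{uv}(i,j)=\top$, and each terminal $t\in T$ is adjacent to all its copies $t_i$, $i\in W$. (Such a minimal set $\bar X$ is what the reverse-deletion phase of the Demaine–Hajiaghayi–Klein primal-dual algorithm outputs on $G'$.) -}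

module Defs where

open import Data.Nat using (ℕ)
open import Data.Fin using (Fin; _≤_)
open import Data.Bool using (Bool; true; false)
open import Data.Product using (_×_)
open import Data.Empty using (⊥)
open import Relation.Binary.PropositionalEquality using (_≡_; _≢_)
open import Relation.Unary using (Pred; _⊆_)
open import Level using (0ℓ)

-- A Steiner tree activation instance.
--  * V = Fin n (finite vertex set), E a symmetric loopless edge relation (undirected simple graph).
--  * T ⊆ V the terminals.
--  * W = Fin k : the finite set W ⊆ ℝ≥0, represented through its order type
--    (only the order on W is ever used).
--  * f u v : W × W → {⊤,⊥} monotone, with f u v i j = f v u j i (f_uv(i,j) for edge uv is
--    the same as f_vu(j,i) since the edge is unordered).
record Instance : Set where
  field
    n : ℕ
    k : ℕ
    E : Fin n → Fin n → Bool
    E-sym : ∀ u v → E u v ≡ E v u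
    E-irrefl : ∀ v → E v v ≡ false
    T : Fin n → Bool
    f : Fin n → Fin n → Fin k → Fin k → Bool
    f-sym : ∀ u v i j → f u v i j ≡ f v u j i
    f-mono : ∀ u v {i i′ j j′} → f u v i j ≡ true → i ≤ i′ → j ≤ j′ → f u v i′ j′ ≡ true

module _ (I : Instance) where
  open Instance I

  data V′ : Set where
    term : (t : Fin n) → T t ≡ true → V′
    copy : (v : Fin n) → (i : Fin k) → V′

  Adj : V′ → V′ → Set
  Adj (copy u i) (copy v j) = (E u v ≡ true) × (f u v i j ≡ true)
  Adj (term t _) (copy v i) = t ≡ v
  Adj (copy v i) (term t _) = v ≡ t
  Adj (term _ _) (term _ _) = ⊥

  data WalkIn (X : Pred V′ 0ℓ) : V′ → V′ → Set where
    here : ∀ {x} → X x → WalkIn X x x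
    step : ∀ {x y z} → X x → Adj x y → WalkIn X y z → WalkIn X x z

  Connected : Pred V′ 0ℓ → Set
  Connected X = ∀ {x y} → X x → X y → WalkIn X x y

  ContainsTerminals : Pred V′ 0ℓ → Set
  ContainsTerminals X = ∀ t (p : T t ≡ true) → X (term t p)

  Feasible : Pred V′ 0ℓ → Set
  Feasible X = ContainsTerminals X × Connected X

  MinimalFeasible : Pred V′ 0ℓ → Set₁
  MinimalFeasible X = Feasible X × (∀ (Y : Pred V′ 0ℓ) → Y ⊆ X → Feasible Y → X ⊆ Y)

-- If copies v_i and v_j with i < j both lie in X, then by monotonicity of f every
-- neighbour of v_i is a neighbour of v_j. Redirecting v_i to v_j therefore maps walks
-- of G'[X] to walks of G'[X ∖ {v_i}], so X ∖ {v_i} is still feasible, contradicting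
-- the minimality of X.
module Submission where

open import Defs
open import Data.Fin using (Fin; _≤_; _<_)
open import Data.Fin.Properties using (_≟_; ≤-refl; <-cmp; <⇒≢)
open import Data.Nat.Properties using (<⇒≤)
import Data.Bool as Bool
open import Data.Product using (_×_; _,_; proj₁; proj₂)
open import Data.Empty using (⊥; ⊥-elim)
open import Relation.Nullary using (¬_; yes; no)
open import Relation.Binary using (tri<; tri≈; tri>)
open import Relation.Binary.Definitions using (DecidableEquality)
open import Relation.Binary.PropositionalEquality
  using (_≡_; _≢_; refl; sym; trans; subst₂; cong)
open import Relation.Unary using (Pred; _⊆_; _∖_; ｛_｝)
open import Axiom.UniquenessOfIdentityProofs using (module Decidable⇒UIP)
open import Level using (0ℓ)

module _ (I : Instance) where
  open Instance I

  _≟ᵛ_ : DecidableEquality (V′ I)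
  term t p ≟ᵛ term t′ p′ with t ≟ t′
  ... | yes refl = yes (cong (term t) (Decidable⇒UIP.≡-irrelevant Bool._≟_ p p′))
  ... | no t≢t′  = no λ { refl → t≢t′ refl }
  term _ _ ≟ᵛ copy _ _ = no λ ()
  copy _ _ ≟ᵛ term _ _ = no λ ()
  copy u i ≟ᵛ copy v j with u ≟ v | i ≟ j
  ... | yes refl | yes refl = yes refl
  ... | no u≢v   | _        = no λ { refl → u≢v refl }
  ... | yes _    | no i≢j   = no λ { refl → i≢j refl }

  Adj-sym : ∀ x y → Adj I x y → Adj I y x
  Adj-sym (term _ _) (copy _ _) t≡v      = sym t≡v
  Adj-sym (copy _ _) (term _ _) v≡t      = sym v≡t
  Adj-sym (copy u i) (copy v j) (e , f≡) =
    trans (sym (E-sym u v)) e , trans (sym (f-sym u v i j)) f≡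

  Adj-irrefl : ∀ x → ¬ Adj I x x
  Adj-irrefl (copy v _) (e , _) with trans (sym e) (E-irrefl v)
  ... | ()

  Dominates : V′ I → V′ I → Set
  Dominates b a = ∀ y → Adj I a y → Adj I b y

  copy-dominates : ∀ {v i j} → i ≤ j → Dominates (copy v j) (copy v i)
  copy-dominates     i≤j (term _ _) v≡t      = v≡t
  copy-dominates {v} i≤j (copy w _) (e , f≡) = e , f-mono v w f≡ i≤j ≤-refl

  map-WalkIn : ∀ {X Y : Pred (V′ I) 0ℓ} (φ : V′ I → V′ I) →
               (∀ {x} → X x → Y (φ x)) → (∀ {x y} → Adj I x y → Adj I (φ x) (φ y)) →
               ∀ {x y} → WalkIn I X x y → WalkIn I Y (φ x) (φ y)
  map-WalkIn φ φ-into φ-adj (here Xx)        = here (φ-into Xx)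
  map-WalkIn φ φ-into φ-adj (step Xx x~y w) =
    step (φ-into Xx) (φ-adj x~y) (map-WalkIn φ φ-into φ-adj w)

  Connected-retract : ∀ {X Y : Pred (V′ I) 0ℓ} (φ : V′ I → V′ I) → Y ⊆ X →
                      (∀ {x} → X x → Y (φ x)) → (∀ {y} → Y y → φ y ≡ y) →
                      (∀ {x y} → Adj I x y → Adj I (φ x) (φ y)) →
                      Connected I X → Connected I Y
  Connected-retract φ Y⊆X φ-into φ-fix φ-adj X-conn Yx Yy =
    subst₂ (WalkIn I _) (φ-fix Yx) (φ-fix Yy)
      (map-WalkIn φ φ-into φ-adj (X-conn (Y⊆X Yx) (Y⊆X Yy)))

  module Collapse (a b : V′ I) where

    collapse : V′ I → V′ I
    collapse x with x ≟ᵛ a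
    ... | yes _ = b
    ... | no _  = x

    collapse-fix : ∀ {x} → x ≢ a → collapse x ≡ x
    collapse-fix {x} x≢a with x ≟ᵛ a
    ... | yes x≡a = ⊥-elim (x≢a x≡a)
    ... | no _    = refl

    collapse-into : ∀ {X : Pred (V′ I) 0ℓ} → a ≢ b → X b →
                    ∀ {x} → X x → (X ∖ ｛ a ｝) (collapse x)
    collapse-into a≢b Xb {x} Xx with x ≟ᵛ a
    ... | yes _   = Xb , a≢b
    ... | no x≢a = Xx , λ a≡x → x≢a (sym a≡x)

    collapse-Adj : Dominates b a → ∀ {x y} → Adj I x y → Adj I (collapse x) (collapse y)
    collapse-Adj b≽a {x} {y} x~y with x ≟ᵛ a | y ≟ᵛ a
    ... | yes refl | yes refl = ⊥-elim (Adj-irrefl a x~y)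
    ... | yes refl | no _     = b≽a y x~y
    ... | no _     | yes refl = Adj-sym b x (b≽a x (Adj-sym x a x~y))
    ... | no _     | no _     = x~y

  Feasible-∖-dominated : ∀ {X a b} → Feasible I X → X b → a ≢ b →
                         (∀ t p → term t p ≢ a) → Dominates b a →
                         Feasible I (X ∖ ｛ a ｝)
  Feasible-∖-dominated {X} {a} {b} (X-terms , X-conn) Xb a≢b a-nonterminal b≽a =
    (λ t p → X-terms t p , λ a≡t → a-nonterminal t p (sym a≡t)) ,
    Connected-retract collapse proj₁ (collapse-into {X} a≢b Xb)
      (λ { (_ , a∉) → collapse-fix λ y≡a → a∉ (sym y≡a) }) (collapse-Adj b≽a) X-conn
    where open Collapse a b

  MinimalFeasible⇒∖-infeasible : ∀ {X a} → MinimalFeasible I X → X a →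
                                  ¬ Feasible I (X ∖ ｛ a ｝)
  MinimalFeasible⇒∖-infeasible {X} {a} (_ , minimal) Xa feasible =
    proj₂ (minimal (X ∖ ｛ a ｝) proj₁ feasible Xa) refl

  MinimalFeasible⇒no-lower-copy : ∀ {X v i j} → MinimalFeasible I X → i < j →
                                   X (copy v i) → X (copy v j) → ⊥
  MinimalFeasible⇒no-lower-copy X-min@(X-feasible , _) i<j Xi Xj =
    MinimalFeasible⇒∖-infeasible X-min Xi
      (Feasible-∖-dominated X-feasible Xj (λ { refl → <⇒≢ i<j refl }) (λ _ _ ())
        (copy-dominates (<⇒≤ i<j)))

lemma8 : (I : Instance) → (X : Pred (V′ I) 0ℓ) → MinimalFeasible I X →
    (v : Fin (Instance.n I)) → (i j : Fin (Instance.k I)) → i ≢ j →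
    ¬ (X (copy v i) × X (copy v j))
lemma8 I X X-min v i j i≢j (Xi , Xj) with <-cmp i j
... | tri< i<j _ _ = MinimalFeasible⇒no-lower-copy I X-min i<j Xi Xj
... | tri≈ _ i≡j _ = i≢j i≡j
... | tri> _ _ j<i = MinimalFeasible⇒no-lower-copy I X-min j<i Xj Xi
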